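{- Let $x$ be a finite partial string over the memory access alphabet, and let $\mathsf{rf}$ be a function assigning to each load $l \in E_x$ on a location $a$ a store $\mathsf{rf}(l) \in E_x$ on $a$. Then $\mathsf{rf}$ satisfies strong read consistency if and only if it satisfies weak read consistency and the synchronizes-with axiom (for every load $l$, $\mathsf{rf}(l) \preceq_x l$).
   Context: A finite partial string is a triple $x = (E_x, \alpha_x, \preceq_x)$ with $E_x$ a finite set of events, $\alpha_x$ a labelling of events and $\preceq_x$ a partial order on $E_x$. Memory access alphabet: fix disjoint sets of locations and registers; labels are load labels $(t, r, a)$ with $t \in \{\mathsf{none},\mathsf{acquire}\}$, $r$ a register, $a$ a location, and store labels $(t, a, b)$ with $t \in \{\mathsf{none},\mathsf{release}\}$, $a$ a location, $b \in \{0,1\}$. An event is a load (resp. store) on $a$ if its label is a load (resp. store) label with location $a$. For a load $l$ on $a$, $\mathcal{H}_x(l) = \{s \in E_x : s \preceq_x l,\ s \text{ a store on } a\}$ and $\bigvee \mathcal{H}_x(l)$ is its least upper bound in $(E_x,\preceq_x)$, with $\bigvee\emptyset = \bot$ a formal element below every event. Weak read consistency: for every location $a$ and all loads $l$ and stores $s$ on $a$, $\bigvee \mathcal{H}_x(l)$ exists and $\mathsf{rf}(l) = s$ implies $\bigvee \mathcal{H}_x(l) \preceq_x s$. Strong read consistency: for every location $a$ and all loads $l$ and stores $s$ on $a$, $\bigvee \mathcal{H}_x(l)$ exists and $\mathsf{rf}(l) = s$ implies $s = \bigvee \mathcal{H}_x(l)$. -}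

module Defs where

open import Level using (Level; _⊔_; suc)
open import Data.Nat using (ℕ)
open import Data.Fin using (Fin)
open import Data.Bool using (Bool)
open import Data.Maybe using (Maybe; just; nothing)
open import Data.Product using (Σ; ∃; _×_; _,_)
open import Data.Unit using (⊤)
open import Data.Empty using (⊥)
open import Relation.Binary.PropositionalEquality using (_≡_)
open import Relation.Binary.Structures using (IsPartialOrder)

-- Memory access alphabet, parameterised by a type of locations and a
-- type of registers (disjointness is automatic: they are separate types).

data LoadType : Set where
  none acquire : LoadType

data StoreType : Set where
  none release : StoreType

data Label (Loc Reg : Set) : Set where
  load  : LoadType → Reg → Loc → Label Loc Reg
  store : StoreType → Loc → Bool → Label Loc Reg

record PartialString (Loc Reg : Set) : Set₁ where
  field
    size      : ℕ
    label     : Fin size → Label Loc Reg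
    _≼_       : Fin size → Fin size → Set
    isPartial : IsPartialOrder _≡_ _≼_

module _ {Loc Reg : Set} (x : PartialString Loc Reg) where
  open PartialString x

  E : Set
  E = Fin size

  IsLoadOn : E → Loc → Set
  IsLoadOn e a = ∃ λ t → ∃ λ r → label e ≡ load t r a

  IsStoreOn : E → Loc → Set
  IsStoreOn e a = ∃ λ t → ∃ λ b → label e ≡ store t a b

  IsLoad : E → Set
  IsLoad e = ∃ λ a → IsLoadOn e a

  H : E → Loc → E → Set
  H l a s = (s ≼ l) × IsStoreOn s a

  -- E_x extended with a formal bottom ⊥ (= nothing), ordered with ⊥ least
  _≼⊥_ : Maybe E → Maybe E → Set
  nothing ≼⊥ _       = ⊤
  just e  ≼⊥ nothing = ⊥
  just e  ≼⊥ just f  = e ≼ f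

  IsLub : (E → Set) → Maybe E → Set
  IsLub P m = (∀ s → P s → just s ≼⊥ m)
            × (∀ u → (∀ s → P s → just s ≼⊥ u) → m ≼⊥ u)

  RF : Set
  RF = (l : E) → IsLoad l → E

  WellTypedRF : RF → Set
  WellTypedRF rf = ∀ l a (p : IsLoadOn l a) → IsStoreOn (rf l (a , p)) a

  WeakReadConsistency : RF → Set
  WeakReadConsistency rf =
    ∀ a l (p : IsLoadOn l a) →
      (∃ λ m → IsLub (H l a) m)
      × (∀ s → IsStoreOn s a → rf l (a , p) ≡ s →
           ∀ m → IsLub (H l a) m → m ≼⊥ just s)

  StrongReadConsistency : RF → Set
  StrongReadConsistency rf =
    ∀ a l (p : IsLoadOn l a) →
      (∃ λ m → IsLub (H l a) m)
      × (∀ s → IsStoreOn s a → rf l (a , p) ≡ s →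
           ∀ m → IsLub (H l a) m → just s ≡ m)

  SynchronizesWith : RF → Set
  SynchronizesWith rf = ∀ l (p : IsLoad l) → rf l p ≼ l

-- Fix a load l on a with store s = rf(l) and let m = ⋁ H(l) (in E ∪ {⊥}).
-- Strong consistency says just s = m, weak consistency says m ≼ s.
--
-- (⇒) From just s = m we get m ≼ s by reflexivity of the lifted order
--     (weak consistency), and s ≼ l because l itself is an upper bound of
--     H(l), so the least upper bound m lies below l (synchronizes-with).
-- (⇐) Synchronizes-with gives s ≼ l, so s ∈ H(l) and hence s ≼ m; together
--     with m ≼ s from weak consistency, antisymmetry yields just s = m.
module Submission where

open import Defs
open import Data.Product using (_×_; _,_; proj₁; proj₂)
open import Data.Maybe using (Maybe; just; nothing)
open import Function.Bundles using (_⇔_; mk⇔)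
open import Relation.Binary.PropositionalEquality using (_≡_; refl; sym; cong; subst)
open import Relation.Binary.Structures using (IsPartialOrder)

module _ {Loc Reg : Set} (x : PartialString Loc Reg) where
  open PartialString x
  private module PO = IsPartialOrder isPartial

  ≼⊥-refl : (m : Maybe (E x)) → _≼⊥_ x m m
  ≼⊥-refl nothing  = _
  ≼⊥-refl (just e) = PO.refl

  ≼⊥-antisym : {m n : Maybe (E x)} → _≼⊥_ x m n → _≼⊥_ x n m → m ≡ n
  ≼⊥-antisym {nothing} {nothing} _   _   = refl
  ≼⊥-antisym {just e}  {just f}  e≼f f≼e = cong just (PO.antisym e≼f f≼e)

  -- A load is an upper bound of its own history, hence lies above its lub.
  lub-below-load : ∀ {l a m} → IsLub x (H x l a) m → _≼⊥_ x m (just l)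
  lub-below-load {l} (_ , least) = least (just l) (λ s s∈H → proj₁ s∈H)

  module _ (rf : RF x) where

    -- Strong consistency identifies rf(l) with the lub; reflexivity then
    -- gives the inequality required by weak consistency.
    strong⇒weak : StrongReadConsistency x rf → WeakReadConsistency x rf
    strong⇒weak src a l p = proj₁ (src a l p) , lub-below-read
      where
      lub-below-read : ∀ s → IsStoreOn x s a → rf l (a , p) ≡ s →
                       ∀ m → IsLub x (H x l a) m → _≼⊥_ x m (just s)
      lub-below-read s s-store rf≡s m lub =
        subst (λ n → _≼⊥_ x n (just s))
              (proj₂ (src a l p) s s-store rf≡s m lub)
              (≼⊥-refl (just s))

    -- rf(l) is a store on the load's location, so strong consistency makes it
    -- the lub of H(l), which lies below l.
    strong⇒sync : WellTypedRF x rf → StrongReadConsistency x rf →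
                  SynchronizesWith x rf
    strong⇒sync wt src l (a , p) =
      subst (λ n → _≼⊥_ x n (just l)) (sym read≡lub) (lub-below-load {m = m} lub)
      where
      m   = proj₁ (proj₁ (src a l p))
      lub = proj₂ (proj₁ (src a l p))
      read≡lub : just (rf l (a , p)) ≡ m
      read≡lub = proj₂ (src a l p) (rf l (a , p)) (wt l a p) refl m lub

    -- The read store is in H(l) by synchronizes-with, so it lies below the
    -- lub; weak consistency gives the converse and antisymmetry concludes.
    weak×sync⇒strong : WeakReadConsistency x rf × SynchronizesWith x rf →
                       StrongReadConsistency x rf
    weak×sync⇒strong (wrc , sync) a l p = proj₁ (wrc a l p) , read-is-lub
      where
      read-is-lub : ∀ s → IsStoreOn x s a → rf l (a , p) ≡ s →
                    ∀ m → IsLub x (H x l a) m → just s ≡ m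
      read-is-lub s s-store refl m lub =
        ≼⊥-antisym (proj₁ lub s (sync l (a , p) , s-store))
                   (proj₂ (wrc a l p) s s-store refl m lub)

proposition10 : {Loc Reg : Set} (x : PartialString Loc Reg) (rf : RF x) →
    WellTypedRF x rf →
    StrongReadConsistency x rf ⇔ (WeakReadConsistency x rf × SynchronizesWith x rf)
proposition10 x rf wt =
  mk⇔ (λ src → strong⇒weak x rf src , strong⇒sync x rf wt src)
      (weak×sync⇒strong x rf)
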